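{- Let $m\ge 1$ and let $P_1,\dots,P_m$ each be either the equality relation or the disequality relation on $\mathbb{N}$. Then the relation $P_1(x_1,x'_1)\vee\dots\vee P_m(x_m,x'_m)$ is pp-definable in the structure $(\mathbb{N};\neq,\,x=y\vee u=v)$.
   Context: $(\mathbb{N};\neq,x=y\vee u=v)$ is the structure on $\mathbb{N}$ with the binary disequality relation and the 4-ary relation $\{(x,y,u,v): x=y\vee u=v\}$. A relation is pp-definable in a structure if it is defined by a formula $\exists y_1\dots\exists y_n\,\Phi$ with $\Phi$ a conjunction of atoms over the structure's relations (and equalities). -}

module Defs where

open import Data.Nat using (ℕ)
open import Data.Fin using (Fin; splitAt; _↑ˡ_; _↑ʳ_)
open import Data.Sum using ([_,_]′; _⊎_)
open import Data.Product using (Σ; ∃; _×_)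
open import Data.List using (List)
open import Data.List.Relation.Unary.All using (All)
open import Relation.Binary.PropositionalEquality using (_≡_; _≢_)
open import Function.Bundles using (_⇔_)

Neq : ℕ → ℕ → Set
Neq a b = a ≢ b

Quad : ℕ → ℕ → ℕ → ℕ → Set
Quad a b c d = (a ≡ b) ⊎ (c ≡ d)

data Atom (V : Set) : Set where
  eqA   : V → V → Atom V
  neqA  : V → V → Atom V
  quadA : V → V → V → V → Atom V

⟦_⟧A : {V : Set} → Atom V → (V → ℕ) → Set
⟦ eqA i j ⟧A ρ = ρ i ≡ ρ j
⟦ neqA i j ⟧A ρ = Neq (ρ i) (ρ j)
⟦ quadA i j u v ⟧A ρ = Quad (ρ i) (ρ j) (ρ u) (ρ v)

-- A primitive positive formula with k free variables: ∃ y₁ … yₙ, a conjunction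
-- (list) of atoms over the variables Fin (k + n) (first k free, last n bound).
record PPFormula (k : ℕ) : Set where
  field
    nBound : ℕ
    atoms  : List (Atom (Fin (k Data.Nat.+ nBound)))

open PPFormula public

env : {k n : ℕ} → (Fin k → ℕ) → (Fin n → ℕ) → Fin (k Data.Nat.+ n) → ℕ
env {k} x y i = [ x , y ]′ (splitAt k i)

⟦_⟧pp : {k : ℕ} → PPFormula k → (Fin k → ℕ) → Set
⟦ φ ⟧pp x = Σ (Fin (nBound φ) → ℕ) λ y → All (λ a → ⟦ a ⟧A (env x y)) (atoms φ)

PPDefinable : {k : ℕ} → ((Fin k → ℕ) → Set) → Set
PPDefinable {k} R = Σ (PPFormula k) λ φ → ∀ x → R x ⇔ ⟦ φ ⟧pp x

data EqOrNeq : Set where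
  isEq isNeq : EqOrNeq

⟦_⟧P : EqOrNeq → ℕ → ℕ → Set
⟦ isEq ⟧P a b = a ≡ b
⟦ isNeq ⟧P a b = a ≢ b

-- The relation P₁(x₁,x₁') ∨ … ∨ Pₘ(xₘ,xₘ') of arity m + m, where the
-- variables are ordered x₁,…,xₘ,x₁',…,xₘ'.
DisjRel : (m : ℕ) → (Fin m → EqOrNeq) → (Fin (m Data.Nat.+ m) → ℕ) → Set
DisjRel m P a = Σ (Fin m) λ i → ⟦ P i ⟧P (a (i ↑ˡ m)) (a (m ↑ʳ i))

-- A disequality x ≠ y inside a disjunction is traded for the equality x = z
-- and the conjunct z ≠ y, with z existentially quantified: take z = x when
-- x ≠ y, and otherwise z = y + 1 (this is where the infinity of ℕ is used).
-- Two equalities are merged with the quaternary relation: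
--   a = b ∨ c = d ∨ Φ   iff   ∃ w. (a = b ∨ c = w) ∧ (w = d ∨ Φ).
-- Each merge shortens the disjunction by one, so a clause of m literals is
-- rewritten in m steps into primitive positive form, ending in one equality.
module Submission where

open import Defs
open import Data.Nat using (ℕ; zero; suc; _+_; _≤_)
open import Data.Nat.Properties using (1+n≢n)
open import Data.Fin using (Fin; zero; suc; join; _↑ˡ_; _↑ʳ_)
open import Data.Fin.Properties using (splitAt-join; ⊎⇔∃)
open import Data.Vec.Functional as Vector using (head; tail)
open import Data.Vec.Functional.Properties using (lookup-++ˡ; lookup-++ʳ)
open import Data.Maybe using (Maybe; just; nothing; maybe′)
open import Data.Sum using (_⊎_; inj₁; inj₂; [_,_]′; map₂)
open import Data.Sum.Function.Propositional using (_⊎-⇔_)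
open import Data.Product using (Σ; ∃; _×_; _,_)
open import Data.List using (List; [_]; map; _++_)
open import Data.List.Relation.Unary.All as All using (All; []; _∷_)
open import Data.List.Relation.Unary.All.Properties using (map⁺; map⁻; ++⁺; ++⁻)
open import Function using (_∘_; id)
open import Function.Bundles using (_⇔_; mk⇔; Equivalence)
open import Function.Construct.Composition using (_⇔-∘_)
open import Function.Construct.Identity using (⇔-id)
open import Function.Construct.Symmetry using (⇔-sym)
open import Function.Related.TypeIsomorphisms using (¬-cong-⇔)
open import Relation.Binary.PropositionalEquality
  using (_≡_; _≢_; _≗_; refl; sym; cong; subst₂)

open Equivalence using (to; from)

private variable
  A B C B′ : Set
  V W : Set
  m : ℕ

Rel : Set → Set₁
Rel V = (V → ℕ) → Set

≢⊎⇔∃≢×≡⊎ : {x y : ℕ} {P : Set} → (x ≢ y ⊎ P) ⇔ (∃ λ z → z ≢ y × (x ≡ z ⊎ P))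
≢⊎⇔∃≢×≡⊎ {x} {y} {P} = mk⇔ witness eliminate
  where
  witness : x ≢ y ⊎ P → ∃ λ z → z ≢ y × (x ≡ z ⊎ P)
  witness (inj₁ x≢y) = x , x≢y , inj₁ refl
  witness (inj₂ p)   = suc y , 1+n≢n , inj₂ p
  eliminate : (∃ λ z → z ≢ y × (x ≡ z ⊎ P)) → x ≢ y ⊎ P
  eliminate (_ , z≢y , inj₁ refl) = inj₁ z≢y
  eliminate (_ , _   , inj₂ p)    = inj₂ p

≡⊎≡⊎⇔∃Quad×≡⊎ : {a b c d : ℕ} {P : Set} →
  (a ≡ b ⊎ c ≡ d ⊎ P) ⇔ (∃ λ w → Quad a b c w × (w ≡ d ⊎ P))
≡⊎≡⊎⇔∃Quad×≡⊎ {a} {b} {c} {d} {P} = mk⇔ witness eliminate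
  where
  witness : a ≡ b ⊎ c ≡ d ⊎ P → ∃ λ w → Quad a b c w × (w ≡ d ⊎ P)
  witness (inj₁ a≡b)        = d , inj₁ a≡b , inj₁ refl
  witness (inj₂ (inj₁ c≡d)) = c , inj₂ refl , inj₁ c≡d
  witness (inj₂ (inj₂ p))   = c , inj₂ refl , inj₂ p
  eliminate : (∃ λ w → Quad a b c w × (w ≡ d ⊎ P)) → a ≡ b ⊎ c ≡ d ⊎ P
  eliminate (_ , inj₁ a≡b  , _)        = inj₁ a≡b
  eliminate (_ , inj₂ refl , inj₁ c≡d) = inj₂ (inj₁ c≡d)
  eliminate (_ , inj₂ _    , inj₂ p)   = inj₂ (inj₂ p)

⊎-swapˡ-⇔ : (A ⊎ B ⊎ C) ⇔ (B ⊎ A ⊎ C)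
⊎-swapˡ-⇔ = mk⇔ swapˡ swapˡ
  where
  swapˡ : {A B C : Set} → A ⊎ B ⊎ C → B ⊎ A ⊎ C
  swapˡ = [ inj₂ ∘ inj₁ , map₂ inj₂ ]′

[,]-∘-map₂ : {f : A → ℕ} {g : B → ℕ} {h : B′ → B} {g′ : B′ → ℕ} →
  g ∘ h ≗ g′ → [ f , g ]′ ∘ map₂ h ≗ [ f , g′ ]′
[,]-∘-map₂ e (inj₁ _) = refl
[,]-∘-map₂ e (inj₂ x) = e x

mapAtom : (V → W) → Atom V → Atom W
mapAtom f (eqA i j)       = eqA (f i) (f j)
mapAtom f (neqA i j)      = neqA (f i) (f j)
mapAtom f (quadA i j u v) = quadA (f i) (f j) (f u) (f v)

⟦mapAtom⟧ : {σ : W → ℕ} {ρ : V → ℕ} (f : V → W) → σ ∘ f ≗ ρ →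
  (a : Atom V) → ⟦ mapAtom f a ⟧A σ ⇔ ⟦ a ⟧A ρ
⟦mapAtom⟧ f e (eqA i j)       = ≡-cong-⇔ (e i) (e j)
  where
  ≡-cong-⇔ : {a a′ b b′ : ℕ} → a ≡ a′ → b ≡ b′ → (a ≡ b) ⇔ (a′ ≡ b′)
  ≡-cong-⇔ p q = mk⇔ (subst₂ _≡_ p q) (subst₂ _≡_ (sym p) (sym q))
⟦mapAtom⟧ {σ = σ} f e (neqA i j) = ¬-cong-⇔ (⟦mapAtom⟧ {σ = σ} f e (eqA i j))
⟦mapAtom⟧ {σ = σ} f e (quadA i j u v) =
  ⟦mapAtom⟧ {σ = σ} f e (eqA i j) ⊎-⇔ ⟦mapAtom⟧ {σ = σ} f e (eqA u v)

Satisfies : (V → ℕ) → List (Atom V) → Set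
Satisfies ρ = All (λ a → ⟦ a ⟧A ρ)

Satisfies-mapAtom : {σ : W → ℕ} {ρ : V → ℕ} (f : V → W) → σ ∘ f ≗ ρ →
  (as : List (Atom V)) → Satisfies σ (map (mapAtom f) as) ⇔ Satisfies ρ as
Satisfies-mapAtom f e as = mk⇔
  (All.map (λ {a} → to (⟦mapAtom⟧ f e a)) ∘ map⁻)
  (map⁺ ∘ All.map (λ {a} → from (⟦mapAtom⟧ f e a)))

record Formula (V : Set) : Set where
  field
    width     : ℕ
    conjuncts : List (Atom (V ⊎ Fin width))

open Formula

_⊨_ : (V → ℕ) → Formula V → Set
ρ ⊨ φ = ∃ λ (y : Fin (width φ) → ℕ) → Satisfies [ ρ , y ]′ (conjuncts φ)

Definable : Rel V → Set
Definable R = Σ (Formula _) λ φ → ∀ ρ → R ρ ⇔ ρ ⊨ φ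

Definable-resp : {R S : Rel V} → (∀ ρ → R ρ ⇔ S ρ) → Definable R → Definable S
Definable-resp R⇔S (φ , R⇔) = φ , λ ρ → R⇔ ρ ⇔-∘ ⇔-sym (R⇔S ρ)

atom-definable : (a : Atom V) → Definable ⟦ a ⟧A
atom-definable a = φ , λ ρ → mk⇔
  (λ r → (λ ()) , from (⟦mapAtom⟧ inj₁ (λ _ → refl) a) r ∷ [])
  (λ { (_ , p ∷ []) → to (⟦mapAtom⟧ inj₁ (λ _ → refl) a) p })
  where
  φ : Formula _
  φ = record { width = 0 ; conjuncts = [ mapAtom inj₁ a ] }

×-definable : {R S : Rel V} → Definable R → Definable S → Definable (λ ρ → R ρ × S ρ)
×-definable {V = V} {R} {S} (φ , R⇔) (ψ , S⇔) = χ , λ ρ → mk⇔ (combine ρ) (separate ρ)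
  where
  k n : ℕ
  k = width φ
  n = width ψ
  left : V ⊎ Fin k → V ⊎ Fin (k + n)
  left = map₂ (_↑ˡ n)
  right : V ⊎ Fin n → V ⊎ Fin (k + n)
  right = map₂ (k ↑ʳ_)
  χ : Formula V
  χ = record
    { width     = k + n
    ; conjuncts = map (mapAtom left) (conjuncts φ) ++ map (mapAtom right) (conjuncts ψ)
    }
  combine : ∀ ρ → R ρ × S ρ → ρ ⊨ χ
  combine ρ (r , s) with to (R⇔ ρ) r | to (S⇔ ρ) s
  ... | y , ps | z , qs = y Vector.++ z ,
    ++⁺ (from (Satisfies-mapAtom left ([,]-∘-map₂ (lookup-++ˡ y z)) _) ps)
        (from (Satisfies-mapAtom right ([,]-∘-map₂ (lookup-++ʳ y z)) _) qs)
  separate : ∀ ρ → ρ ⊨ χ → R ρ × S ρ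
  separate ρ (y , ps) with ++⁻ _ ps
  ... | qs , rs =
    from (R⇔ ρ) (y ∘ (_↑ˡ n) , to (Satisfies-mapAtom left ([,]-∘-map₂ λ _ → refl) _) qs) ,
    from (S⇔ ρ) (y ∘ (k ↑ʳ_) , to (Satisfies-mapAtom right ([,]-∘-map₂ λ _ → refl) _) rs)

∃-definable : {R : Rel (Maybe V)} → Definable R → Definable (λ ρ → ∃ λ z → R (maybe′ ρ z))
∃-definable {V = V} {R} (φ , R⇔) = χ , λ ρ → mk⇔ (introduce ρ) (eliminate ρ)
  where
  n : ℕ
  n = width φ
  bind : Maybe V ⊎ Fin n → V ⊎ Fin (suc n)
  bind (inj₁ nothing)  = inj₂ zero
  bind (inj₁ (just v)) = inj₁ v
  bind (inj₂ j)        = inj₂ (suc j)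
  bind-≗ : (ρ : V → ℕ) (y : Fin (suc n) → ℕ) →
    [ ρ , y ]′ ∘ bind ≗ [ maybe′ ρ (head y) , tail y ]′
  bind-≗ ρ y (inj₁ nothing)  = refl
  bind-≗ ρ y (inj₁ (just v)) = refl
  bind-≗ ρ y (inj₂ j)        = refl
  χ : Formula V
  χ = record { width = suc n ; conjuncts = map (mapAtom bind) (conjuncts φ) }
  introduce : ∀ ρ → (∃ λ z → R (maybe′ ρ z)) → ρ ⊨ χ
  introduce ρ (z , r) with to (R⇔ _) r
  ... | y , ps = z Vector.∷ y , from (Satisfies-mapAtom bind (bind-≗ ρ (z Vector.∷ y)) _) ps
  eliminate : ∀ ρ → ρ ⊨ χ → ∃ λ z → R (maybe′ ρ z)
  eliminate ρ (y , ps) = head y , from (R⇔ _) (tail y , to (Satisfies-mapAtom bind (bind-≗ ρ y) _) ps)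

ppDefinable : {k : ℕ} {R : Rel (Fin k)} → Definable R → PPDefinable R
ppDefinable {k} (φ , R⇔) = ψ , λ x → ⊨⇔⟦⟧pp x ⇔-∘ R⇔ x
  where
  n : ℕ
  n = width φ
  ψ : PPFormula k
  ψ = record { nBound = n ; atoms = map (mapAtom (join k n)) (conjuncts φ) }
  env-join : (x : Fin k → ℕ) (y : Fin n → ℕ) → env x y ∘ join k n ≗ [ x , y ]′
  env-join x y i = cong [ x , y ]′ (splitAt-join k n i)
  ⊨⇔⟦⟧pp : (x : Fin k → ℕ) → x ⊨ φ ⇔ ⟦ ψ ⟧pp x
  ⊨⇔⟦⟧pp x = mk⇔
    (λ (y , ps) → y , from (Satisfies-mapAtom (join k n) (env-join x y) _) ps)
    (λ (y , ps) → y , to (Satisfies-mapAtom (join k n) (env-join x y) _) ps)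

≢⊎-definable : (x y : V) (Φ : Rel V) →
  Definable (λ σ → σ (just x) ≡ σ nothing ⊎ Φ (σ ∘ just)) →
  Definable (λ ρ → ρ x ≢ ρ y ⊎ Φ ρ)
≢⊎-definable x y Φ D = Definable-resp (λ _ → ⇔-sym ≢⊎⇔∃≢×≡⊎)
  (∃-definable (×-definable (atom-definable (neqA nothing (just y))) D))

≡⊎≡⊎-definable : (a b c d : V) (Φ : Rel V) →
  Definable (λ σ → σ nothing ≡ σ (just d) ⊎ Φ (σ ∘ just)) →
  Definable (λ ρ → ρ a ≡ ρ b ⊎ ρ c ≡ ρ d ⊎ Φ ρ)
≡⊎≡⊎-definable a b c d Φ D = Definable-resp (λ _ → ⇔-sym ≡⊎≡⊎⇔∃Quad×≡⊎)
  (∃-definable (×-definable (atom-definable (quadA (just a) (just b) (just c) nothing)) D))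

record Literal (V : Set) : Set where
  constructor literal
  field
    relation : EqOrNeq
    lhs rhs  : V

⟦_⟧L : Literal V → Rel V
⟦ literal P u v ⟧L ρ = ⟦ P ⟧P (ρ u) (ρ v)

Clause : Set → ℕ → Set
Clause V m = Fin m → Literal V

⟦_⟧C : Clause V m → Rel V
⟦ L ⟧C ρ = ∃ λ i → ⟦ L i ⟧L ρ

weaken : Clause V m → Clause (Maybe V) m
weaken L i = literal P (just u) (just v)
  where open Literal (L i) renaming (relation to P; lhs to u; rhs to v)

≡⊎clause-definable : ∀ m (a b : V) (T : Clause V m) →
  Definable (λ ρ → ρ a ≡ ρ b ⊎ ⟦ T ⟧C ρ)
≡⊎clause-definable zero a b T =
  Definable-resp (λ _ → mk⇔ inj₁ [ id , (λ { (() , _) }) ]′) (atom-definable (eqA a b))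
≡⊎clause-definable (suc m) a b T =
  Definable-resp (λ _ → ⇔-id _ ⊎-⇔ ⊎⇔∃) (≡⊎literal⊎-definable (T zero))
  where
  T′ : Clause _ m
  T′ = T ∘ suc
  ≡⊎literal⊎-definable : (l : Literal _) → Definable (λ ρ → ρ a ≡ ρ b ⊎ ⟦ l ⟧L ρ ⊎ ⟦ T′ ⟧C ρ)
  ≡⊎literal⊎-definable (literal isEq c d) = ≡⊎≡⊎-definable a b c d ⟦ T′ ⟧C
    (≡⊎clause-definable m nothing (just d) (weaken T′))
  ≡⊎literal⊎-definable (literal isNeq c d) = Definable-resp (λ _ → ⊎-swapˡ-⇔)
    (≢⊎-definable c d (λ ρ → ρ a ≡ ρ b ⊎ ⟦ T′ ⟧C ρ)
      (≡⊎≡⊎-definable (just c) nothing (just a) (just b) (⟦ T′ ⟧C ∘ (_∘ just))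
        (≡⊎clause-definable m nothing (just (just b)) (weaken (weaken T′)))))

clause-definable : ∀ m (L : Clause V (suc m)) → Definable ⟦ L ⟧C
clause-definable m L = Definable-resp (λ _ → ⊎⇔∃) (literal⊎-definable (L zero))
  where
  L′ : Clause _ m
  L′ = L ∘ suc
  literal⊎-definable : (l : Literal _) → Definable (λ ρ → ⟦ l ⟧L ρ ⊎ ⟦ L′ ⟧C ρ)
  literal⊎-definable (literal isEq a b)  = ≡⊎clause-definable m a b L′
  literal⊎-definable (literal isNeq x y) = ≢⊎-definable x y ⟦ L′ ⟧C
    (≡⊎clause-definable m (just x) nothing (weaken L′))

mainTheorem10 : (m : ℕ) → 1 ≤ m → (P : Fin m → EqOrNeq) →
    PPDefinable (DisjRel m P)
mainTheorem10 (suc m) _ P =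
  ppDefinable (clause-definable m λ i → literal (P i) (i ↑ˡ suc m) (suc m ↑ʳ i))
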